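{- Let $t \geq 1$ be an integer and let $q$ be a prime power such that $t$ divides $q-1$. Let $\theta$ be a generator of the multiplicative group $\mathbb{F}_{q^2}^* = \mathbb{F}_{q^2}\setminus\{0\}$, and let \[ A = \{a \in \mathbb{Z}_{q^2-1} : \theta^a - \theta \in \mathbb{F}_q\} \] (so $|A| = q$). Let $H$ be the subgroup of $\mathbb{Z}_{q^2-1}$ generated by $\left(\frac{q-1}{t}\right)(q+1)$. Let $G_{q,t}$ be the bipartite graph with parts $X$ and $Y$, each a disjoint copy of the quotient group $\mathbb{Z}_{q^2-1}/H$, in which a vertex $x+H \in X$ is adjacent to the vertex $x+a+H \in Y$ for every $a \in A$ (and there are no other edges). Then $G_{q,t}$ is a bipartite graph with $\frac{q^2-1}{t}$ vertices in each part, contains no subgraph isomorphic to $K_{2,t+1}$, and has $q\left(\frac{q^2-1}{t}\right)$ edges.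
   Context: $\mathbb{F}_q$ denotes the finite field with $q$ elements, viewed as a subfield of $\mathbb{F}_{q^2}$; $\mathbb{Z}_{q^2-1}$ is the additive cyclic group of integers modulo $q^2-1$. $K_{2,t+1}$ is the complete bipartite graph with parts of sizes $2$ and $t+1$. -}

module Defs where

open import Level using (Level; _⊔_)
open import Data.Nat using (ℕ; zero; suc; _+_; _*_; _∸_; _^_; _≤_; NonZero)
open import Data.Nat.Primality using (Prime)
open import Data.Nat.Divisibility using (_∣_)
open import Data.Fin using (Fin)
open import Data.Bool using (Bool; true; false)
open import Data.Sum using (_⊎_; inj₁; inj₂)
open import Data.Product using (Σ; ∃; _×_; _,_)
open import Data.Empty using (⊥)
open import Data.Unit using (⊤)
open import Relation.Nullary using (¬_)
open import Relation.Binary.PropositionalEquality using (_≡_)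
import Algebra.Bundles
open Algebra.Bundles using (CommutativeRing)
import Algebra.Definitions.RawSemiring as RS

-- Setoid cardinality: the elements satisfying P, counted up to the
-- equivalence _≈_, are exactly n many (a bijection Fin n ≅ P/≈).
HasCard : ∀ {a r p} {A : Set a} (_≈_ : A → A → Set r) (P : A → Set p) (n : ℕ)
        → Set (a ⊔ r ⊔ p)
HasCard {A = A} _≈_ P n =
  Σ (Fin n → A) λ f →
    (∀ i → P (f i)) ×
    (∀ i j → f i ≈ f j → i ≡ j) ×
    (∀ x → P x → ∃ λ i → x ≈ f i)

IsPrimePower : ℕ → Set
IsPrimePower q = ∃ λ p → ∃ λ k → Prime p × 1 ≤ k × q ≡ p ^ k

module _ {c ℓ} (R : CommutativeRing c ℓ) where
  open CommutativeRing R renaming (_+_ to _+ᴿ_; _*_ to _*ᴿ_)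
  open RS (Algebra.Bundles.Semiring.rawSemiring semiring) using () renaming (_^_ to _^ᴿ_)

  IsField : Set (c ⊔ ℓ)
  IsField = (¬ (1# ≈ 0#)) × (∀ x → ¬ (x ≈ 0#) → ∃ λ y → (x *ᴿ y) ≈ 1#)

  IsSubfield : ∀ {p} → (Carrier → Set p) → Set (c ⊔ ℓ ⊔ p)
  IsSubfield S =
    (∀ x y → x ≈ y → S x → S y) ×
    S 0# × S 1# ×
    (∀ x y → S x → S y → S (x +ᴿ y)) ×
    (∀ x → S x → S (- x)) ×
    (∀ x y → S x → S y → S (x *ᴿ y)) ×
    (∀ x → S x → ¬ (x ≈ 0#) → ∃ λ y → S y × (x *ᴿ y) ≈ 1#)

  IsGenerator : Carrier → Set (c ⊔ ℓ)
  IsGenerator θ = ¬ (θ ≈ 0#) × (∀ x → ¬ (x ≈ 0#) → ∃ λ a → (θ ^ᴿ a) ≈ x)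

  -- the set A ⊆ ℤ_{q²-1} (elements of ℤ_N represented by natural numbers)
  InA : ∀ {p} → (Carrier → Set p) → Carrier → ℕ → Set p
  InA Fq θ a = Fq ((θ ^ᴿ a) - θ)

_≡[mod_]_ : ℕ → ℕ → ℕ → Set
x ≡[mod N ] y = ∃ λ i → ∃ λ j → x + i * N ≡ y + j * N

InSubgroupGen : (N g : ℕ) → ℕ → Set
InSubgroupGen N g z = ∃ λ k → z ≡[mod N ] (k * g)

SameCoset : (N g : ℕ) → ℕ → ℕ → Set
SameCoset N g x y = ∃ λ h → InSubgroupGen N g h × (x + h) ≡[mod N ] y

module Graph {p} (N g : ℕ) (InA : ℕ → Set p) where
  Adj : ℕ → ℕ → Set p
  Adj u v = ∃ λ x → ∃ λ a → InA a × SameCoset N g x u × SameCoset N g (x + a) v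

  -- vertices of G: (false , x) ∈ X, (true , y) ∈ Y
  Vertex : Set
  Vertex = Bool × ℕ

  VEq : Vertex → Vertex → Set
  VEq (b , x) (b' , y) = b ≡ b' × SameCoset N g x y

  GAdj : Vertex → Vertex → Set p
  GAdj (false , u) (true , v) = Adj u v
  GAdj (true , v) (false , u) = Adj u v
  GAdj _ _ = Lift⊥
    where open import Data.Empty.Polymorphic using () renaming (⊥ to Lift⊥)

  -- edges, counted as adjacent pairs (x+H , y+H)
  EdgeEq : ℕ × ℕ → ℕ × ℕ → Set
  EdgeEq (u , v) (u' , v') = SameCoset N g u u' × SameCoset N g v v'

  EdgeP : ℕ × ℕ → Set p
  EdgeP (u , v) = Adj u v

KAdj : (s r : ℕ) → Fin s ⊎ Fin r → Fin s ⊎ Fin r → Set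
KAdj s r (inj₁ _) (inj₂ _) = ⊤
KAdj s r (inj₂ _) (inj₁ _) = ⊤
KAdj s r _ _ = ⊥

ContainsK : ∀ {v e p} {V : Set v} (_≈_ : V → V → Set e) (adj : V → V → Set p)
          → (s r : ℕ) → Set (v ⊔ e ⊔ p)
ContainsK {V = V} _≈_ adj s r =
  Σ (Fin s ⊎ Fin r → V) λ f →
    (∀ i j → f i ≈ f j → i ≡ j) ×
    (∀ i j → KAdj s r i j → adj (f i) (f j))

-- Write θ^a = α a + θ. For a ∈ A the coordinate α a lies in F_q, and since 1, θ are linearly
-- independent over F_q, comparing θ^(a + b') = θ^(a' + b) coefficientwise gives
-- α a + α b' = α a' + α b and α a · α b' = α a' · α b, so {a, b'} = {a', b}: A is a Sidon set
-- modulo N = q² - 1 (Bose). The group F_q^* is generated by θ^d for the least d with θ^d ∈ F_q,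
-- so q - 1 = N / d and d = q + 1; hence θ^(k (q + 1)) ∈ F_q, which keeps the elements of A
-- distinct modulo g = ((q - 1) / t)(q + 1) and gives the q g edges. Two vertices x₀ ≢ x₁ with
-- t + 1 common neighbours give pairs a_k, b_k ∈ A with x₀ + a_k ≡ x₁ + b_k (mod g); the
-- differences (x₁ + b_k) - (x₀ + a_k) lie in H, which has t elements, so two coincide, and the
-- Sidon property then forces a_k ≡ a_k' or x₀ ≡ x₁.

module Submission where

open import Defs
open import Level using (0ℓ)
open import Data.Nat as ℕ
  using (ℕ; zero; suc; _∸_; _/_; _%_; _≤_; _<_; z≤n; s≤s; NonZero)
import Data.Nat.Properties as ℕ
open import Data.Nat.DivMod
open import Data.Nat.Divisibility using (_∣_; m%n≡0⇒n∣m)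
open import Data.Fin as Fin using (Fin; toℕ; fromℕ<)
open import Data.Fin.Patterns using (0F; 1F)
import Data.Fin.Properties as Fin
open import Data.Product using (∃; _×_; _,_; proj₁; proj₂; uncurry)
open import Data.Sum as Sum using (_⊎_; inj₁; inj₂)
open import Data.Sum.Properties using (inj₂-injective)
open import Data.Bool using (Bool; true; false; not)
open import Data.Bool.Properties using (not-injective)
open import Data.Unit using (⊤; tt)
open import Data.Empty using (⊥; ⊥-elim)
open import Relation.Nullary using (¬_; ¬?; Dec; yes; no; contradiction)
open import Relation.Nullary.Decidable using (decidable-stable)
open import Function using (_∘_)
open import Algebra.Bundles using (CommutativeRing)
import Algebra.Bundles
import Algebra.Definitions.RawSemiring as RS
open import Relation.Binary.Bundles using (Setoid)
import Relation.Binary.Reasoning.Setoid as SetoidReasoning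
open import Relation.Binary.PropositionalEquality as ≡ using (_≡_)

module Congruence where

  open import Data.Nat using (_+_; _*_)
  open import Data.Nat.Tactic.RingSolver using (solve-∀)

  module _ {N : ℕ} where

    mod-refl : ∀ {x} → x ≡[mod N ] x
    mod-refl = 0 , 0 , ≡.refl

    mod-reflexive : ∀ {x y} → x ≡ y → x ≡[mod N ] y
    mod-reflexive ≡.refl = mod-refl

    mod-sym : ∀ {x y} → x ≡[mod N ] y → y ≡[mod N ] x
    mod-sym (i , j , e) = j , i , ≡.sym e

    mod-trans : ∀ {x y z} → x ≡[mod N ] y → y ≡[mod N ] z → x ≡[mod N ] z
    mod-trans {x} {y} {z} (i , j , x≡y) (k , l , y≡z) = i + k , l + j , (begin
      x + (i + k) * N       ≡⟨ lhs x i k N ⟩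
      (x + i * N) + k * N   ≡⟨ ≡.cong (_+ k * N) x≡y ⟩
      (y + j * N) + k * N   ≡⟨ swap y j k N ⟩
      (y + k * N) + j * N   ≡⟨ ≡.cong (_+ j * N) y≡z ⟩
      (z + l * N) + j * N   ≡⟨ rhs z l j N ⟩
      z + (l + j) * N       ∎)
      where
      open ≡.≡-Reasoning
      lhs : ∀ x i k N → x + (i + k) * N ≡ (x + i * N) + k * N
      lhs = solve-∀
      swap : ∀ y j k N → (y + j * N) + k * N ≡ (y + k * N) + j * N
      swap = solve-∀
      rhs : ∀ z l j N → (z + l * N) + j * N ≡ z + (l + j) * N
      rhs = solve-∀

    mod-+ : ∀ {x y u v} → x ≡[mod N ] y → u ≡[mod N ] v → (x + u) ≡[mod N ] (y + v)
    mod-+ {x} {y} {u} {v} (i , j , x≡y) (k , l , u≡v) = i + k , j + l ,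
      ≡.trans (regroup x u i k N) (≡.trans (≡.cong₂ _+_ x≡y u≡v) (≡.sym (regroup y v j l N)))
      where
      regroup : ∀ x u i k N → (x + u) + (i + k) * N ≡ (x + i * N) + (u + k * N)
      regroup = solve-∀

    mod-cancelˡ : ∀ z {x y} → (z + x) ≡[mod N ] (z + y) → x ≡[mod N ] y
    mod-cancelˡ z {x} {y} (i , j , e) = i , j ,
      ℕ.+-cancelˡ-≡ z _ _ (≡.trans (≡.sym (ℕ.+-assoc z x (i * N))) (≡.trans e (ℕ.+-assoc z y (j * N))))

    mod-cancelʳ : ∀ z {x y} → (x + z) ≡[mod N ] (y + z) → x ≡[mod N ] y
    mod-cancelʳ z {x} {y} e =
      mod-cancelˡ z (≡.subst₂ (λ a b → a ≡[mod N ] b) (ℕ.+-comm x z) (ℕ.+-comm y z) e)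

    mod-+-multiple : ∀ x k → (x + k * N) ≡[mod N ] x
    mod-+-multiple x k = 0 , k , ℕ.+-identityʳ _

    module _ .{{_ : NonZero N}} where

      mod-% : ∀ x → x ≡[mod N ] (x % N)
      mod-% x = 0 , x / N , ≡.trans (ℕ.+-identityʳ x) (m≡m%n+[m/n]*n x N)

      mod⇒%≡ : ∀ {x y} → x ≡[mod N ] y → x % N ≡ y % N
      mod⇒%≡ {x} {y} (i , j , e) =
        ≡.trans (≡.sym ([m+kn]%n≡m%n x i N)) (≡.trans (≡.cong (_% N) e) ([m+kn]%n≡m%n y j N))

      %≡⇒mod : ∀ {x y} → x % N ≡ y % N → x ≡[mod N ] y
      %≡⇒mod {x} {y} e = mod-trans (mod-% x) (mod-trans (mod-reflexive e) (mod-sym (mod-% y)))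

      mod-<-unique : ∀ {x y} → x < N → y < N → x ≡[mod N ] y → x ≡ y
      mod-<-unique x<N y<N e =
        ≡.trans (≡.sym (m<n⇒m%n≡m x<N)) (≡.trans (mod⇒%≡ e) (m<n⇒m%n≡m y<N))

  mod-setoid : ℕ → Setoid 0ℓ 0ℓ
  mod-setoid N = record
    { Carrier = ℕ
    ; _≈_ = _≡[mod N ]_
    ; isEquivalence = record { refl = mod-refl ; sym = mod-sym ; trans = mod-trans }
    }

  module ModReasoning (N : ℕ) = SetoidReasoning (mod-setoid N)

  module _ (g t : ℕ) where

    mod-coarsen : ∀ {x y} → x ≡[mod g * t ] y → x ≡[mod g ] y
    mod-coarsen {x} {y} (i , j , e) = i * t , j * t ,
      ≡.trans (≡.cong (x +_) (reassoc i)) (≡.trans e (≡.cong (y +_) (≡.sym (reassoc j))))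
      where
      reassoc : ∀ i → i * t * g ≡ i * (g * t)
      reassoc i = ≡.trans (ℕ.*-assoc i t g) (≡.cong (i *_) (ℕ.*-comm t g))

    mod-scale : ∀ {m m'} → m ≡[mod t ] m' → (m * g) ≡[mod g * t ] (m' * g)
    mod-scale {m} {m'} (i , j , e) = i , j ,
      ≡.trans (distrib m i) (≡.trans (≡.cong (_* g) e) (≡.sym (distrib m' j)))
      where
      distrib : ∀ m i → m * g + i * (g * t) ≡ (m + i * t) * g
      distrib m i = factor m i g t
        where
        factor : ∀ m i g t → m * g + i * (g * t) ≡ (m + i * t) * g
        factor = solve-∀

  mod-refine : ∀ g t .{{_ : NonZero t}} {x y} → x ≡[mod g ] y → ∃ λ k → (x + k * g) ≡[mod g * t ] y
  mod-refine g (suc t) {x} {y} (i , j , e) = i + j * t , 0 , j , (begin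
    (x + (i + j * t) * g) + 0      ≡⟨ split x i j t g ⟩
    (x + i * g) + j * t * g        ≡⟨ ≡.cong (_+ j * t * g) e ⟩
    (y + j * g) + j * t * g        ≡⟨ merge y j t g ⟩
    y + j * (g * suc t)            ∎)
    where
    open ≡.≡-Reasoning
    split : ∀ x i j t g → (x + (i + j * t) * g) + 0 ≡ (x + i * g) + j * t * g
    split = solve-∀
    merge : ∀ y j t g → (y + j * g) + j * t * g ≡ y + j * (g * suc t)
    merge = solve-∀

open Congruence

module _ {a r} (S : Setoid a r) where
  open Setoid S

  card-≥-injection : ∀ {p} {P : Carrier → Set p} {n m} → HasCard _≈_ P n →
    (h : Fin m → Carrier) → (∀ i → P (h i)) → (∀ i j → h i ≈ h j → i ≡ j) → m ≤ n
  card-≥-injection (f , _ , _ , f-onto) h h-P h-inj =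
    Fin.injective⇒≤ {f = index} λ {i} {j} e → h-inj i j (trans (h≈f i) (≡.subst (λ k → f k ≈ h j) (≡.sym e) (sym (h≈f j))))
    where
    index = λ i → proj₁ (f-onto (h i) (h-P i))
    h≈f = λ i → proj₂ (f-onto (h i) (h-P i))

  card-≤-covering : ∀ {p} {P : Carrier → Set p} {n m} → HasCard _≈_ P n →
    (h : Fin m → Carrier) → (∀ x → P x → ∃ λ i → x ≈ h i) → n ≤ m
  card-≤-covering (f , f-P , f-inj , _) h h-onto =
    Fin.injective⇒≤ {f = index} λ {i} {j} e → f-inj i j (trans (f≈h i) (≡.subst (λ k → h k ≈ f j) (≡.sym e) (sym (f≈h j))))
    where
    index = λ i → proj₁ (h-onto (f i) (f-P i))
    f≈h = λ i → proj₂ (h-onto (f i) (f-P i))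

  card-unique : ∀ {p} {P : Carrier → Set p} {n m} → HasCard _≈_ P n → HasCard _≈_ P m → n ≡ m
  card-unique cn@(fn , Pn , injn , _) cm@(fm , Pm , injm , _) =
    ℕ.≤-antisym (card-≥-injection cm fn Pn injn) (card-≥-injection cn fm Pm injm)

least-witness : ∀ {p} {P : ℕ → Set p} → (∀ n → Dec (P n)) →
  ∀ {n} → P n → ∃ λ k → P k × (∀ r → r < k → ¬ P r)
least-witness {P = P} P? {n} Pn
  with Fin.¬∀⟶∃¬-smallest (suc n) (λ i → ¬ P (toℕ i)) (λ i → ¬? (P? (toℕ i)))
         (λ ¬Pall → ¬Pall (Fin.fromℕ n) (≡.subst P (≡.sym (Fin.toℕ-fromℕ n)) Pn))
... | k , ¬¬Pk , below = toℕ k , decidable-stable (P? (toℕ k)) ¬¬Pk , λ r r<k →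
  ≡.subst (λ x → ¬ P x) (≡.trans (Fin.toℕ-inject (fromℕ< r<k)) (Fin.toℕ-fromℕ< r<k)) (below (fromℕ< r<k))

module FiniteField {c ℓ} (F : CommutativeRing c ℓ) (isField : IsField F)
  {Q : ℕ} (cardF : HasCard (CommutativeRing._≈_ F) (λ _ → ⊤) Q) where

  open CommutativeRing F
  open RS (Algebra.Bundles.Semiring.rawSemiring semiring) using () renaming (_^_ to _^ᴿ_)
  open import Algebra.Properties.Semiring.Exp semiring using (^-homo-*; ^-assocʳ)
  open SetoidReasoning setoid

  open import Algebra.Properties.Group +-group
    using (x≈z//y; y≈x\\z; \\-leftDividesˡ; //-rightDividesˡ)
    renaming (∙-cancelˡ to +-cancelˡ; ∙-cancelʳ to +-cancelʳ)
  open import Algebra.Solver.Ring.NaturalCoefficients.Default commutativeSemiring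
    using (solve; _:+_; _:*_; _:=_)

  private
    elems : Fin Q → Carrier
    elems = proj₁ cardF

    elems-injective : ∀ i j → elems i ≈ elems j → i ≡ j
    elems-injective = proj₁ (proj₂ (proj₂ cardF))

    index : Carrier → Fin Q
    index x = proj₁ (proj₂ (proj₂ (proj₂ cardF)) x tt)

    ≈elems-index : ∀ x → x ≈ elems (index x)
    ≈elems-index x = proj₂ (proj₂ (proj₂ (proj₂ cardF)) x tt)

  index-≡⇒≈ : ∀ {x y} → index x ≡ index y → x ≈ y
  index-≡⇒≈ {x} {y} e = trans (≈elems-index x) (trans (reflexive (≡.cong elems e)) (sym (≈elems-index y)))

  _≈?_ : ∀ x y → Dec (x ≈ y)
  x ≈? y with index x Fin.≟ index y
  ... | yes e = yes (index-≡⇒≈ e)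
  ... | no ne = no λ x≈y → ne (elems-injective _ _ (trans (sym (≈elems-index x)) (trans x≈y (≈elems-index y))))

  1≉0 : ¬ (1# ≈ 0#)
  1≉0 = proj₁ isField

  *-cancelˡ : ∀ {z x y} → ¬ (z ≈ 0#) → z * x ≈ z * y → x ≈ y
  *-cancelˡ {z} {x} {y} z≉0 zx≈zy with proj₂ isField z z≉0
  ... | w , zw≈1 = begin
    x                ≈⟨ sym (*-identityˡ x) ⟩
    1# * x           ≈⟨ *-congʳ (sym zw≈1) ⟩
    (z * w) * x      ≈⟨ *-congʳ (*-comm z w) ⟩
    (w * z) * x      ≈⟨ *-assoc w z x ⟩
    w * (z * x)      ≈⟨ *-congˡ zx≈zy ⟩
    w * (z * y)      ≈⟨ sym (*-assoc w z y) ⟩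
    (w * z) * y      ≈⟨ *-congʳ (*-comm w z) ⟩
    (z * w) * y      ≈⟨ *-congʳ zw≈1 ⟩
    1# * y           ≈⟨ *-identityˡ y ⟩
    y                ∎

  *-nonzero : ∀ {x y} → ¬ (x ≈ 0#) → ¬ (y ≈ 0#) → ¬ (x * y ≈ 0#)
  *-nonzero {x} x≉0 y≉0 xy≈0 = y≉0 (*-cancelˡ x≉0 (trans xy≈0 (sym (zeroʳ x))))

  equal-sum-and-product : ∀ {x y x' y'} → x + y' ≈ x' + y → x * y' ≈ x' * y → x ≈ x' ⊎ x ≈ y
  equal-sum-and-product {x} {y} {x'} {y'} sum prod = by-difference (- x' + x) (\\-leftDividesˡ x' x)
    where
    by-difference : ∀ u → x' + u ≈ x → x ≈ x' ⊎ x ≈ y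
    by-difference u x'+u≈x with u ≈? 0#
    ... | yes u≈0 = inj₁ (begin
      x             ≈⟨ sym x'+u≈x ⟩
      x' + u        ≈⟨ +-congˡ u≈0 ⟩
      x' + 0#       ≈⟨ +-identityʳ x' ⟩
      x'            ∎)
    ... | no u≉0 = inj₂ (begin
      x             ≈⟨ sym x'+u≈x ⟩
      x' + u        ≈⟨ +-congʳ (sym y'≈x') ⟩
      y' + u        ≈⟨ +-comm y' u ⟩
      u + y'        ≈⟨ u+y'≈y ⟩
      y             ∎)
      where
      u+y'≈y : u + y' ≈ y
      u+y'≈y = +-cancelˡ x' _ _ (begin
        x' + (u + y')  ≈⟨ sym (+-assoc x' u y') ⟩
        (x' + u) + y'  ≈⟨ +-congʳ x'+u≈x ⟩
        x + y'         ≈⟨ sum ⟩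
        x' + y         ∎)
      y'≈x' : y' ≈ x'
      y'≈x' = *-cancelˡ u≉0 (+-cancelˡ (x' * y') _ _ (begin
        x' * y' + u * y'     ≈⟨ sym (distribʳ y' x' u) ⟩
        (x' + u) * y'        ≈⟨ *-congʳ x'+u≈x ⟩
        x * y'               ≈⟨ prod ⟩
        x' * y               ≈⟨ *-congˡ (sym u+y'≈y) ⟩
        x' * (u + y')        ≈⟨ distribˡ x' u y' ⟩
        x' * u + x' * y'     ≈⟨ +-comm _ _ ⟩
        x' * y' + x' * u     ≈⟨ +-congˡ (*-comm x' u) ⟩
        x' * y' + u * x'     ∎))

  expand : ∀ θ x y → (x + θ) * (y + θ) ≈ θ * θ + (θ * (x + y) + x * y)
  expand = solve 3 (λ θ x y → (x :+ θ) :* (y :+ θ) := θ :* θ :+ (θ :* (x :+ y) :+ x :* y)) refl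

  module Cyclic (θ : Carrier) (generator : IsGenerator F θ) {N : ℕ} .{{_ : NonZero N}}
    (Q≡1+N : Q ≡ suc N) where

    θ^_ : ℕ → Carrier
    θ^ n = θ ^ᴿ n

    θ^≉0 : ∀ n → ¬ (θ^ n ≈ 0#)
    θ^≉0 zero    = 1≉0
    θ^≉0 (suc n) = *-nonzero (proj₁ generator) (θ^≉0 n)

    θ^-+ : ∀ m n → θ^ (m ℕ.+ n) ≈ θ^ m * θ^ n
    θ^-+ = ^-homo-* θ

    θ^-≡ : ∀ {m n} → m ≡ n → θ^ m ≈ θ^ n
    θ^-≡ e = reflexive (≡.cong θ^_ e)

    θ^-* : ∀ m k → θ^ (k ℕ.* m) ≈ (θ^ m) ^ᴿ k
    θ^-* m k = sym (trans (^-assocʳ θ m k) (θ^-≡ (ℕ.*-comm m k)))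

    θ^-onto : ∀ x → ¬ (x ≈ 0#) → ∃ λ a → θ^ a ≈ x
    θ^-onto = proj₂ generator

    θ^-cancel : ∀ i k → θ^ i ≈ θ^ (i ℕ.+ k) → θ^ k ≈ 1#
    θ^-cancel i k e = sym (*-cancelˡ (θ^≉0 i) (trans (*-identityʳ _) (trans e (θ^-+ i k))))

    θ^-multiple≈1 : ∀ {m} → θ^ m ≈ 1# → ∀ k → θ^ (k ℕ.* m) ≈ 1#
    θ^-multiple≈1 e zero = refl
    θ^-multiple≈1 {m} e (suc k) = begin
      θ^ (m ℕ.+ k ℕ.* m)     ≈⟨ θ^-+ m (k ℕ.* m) ⟩
      θ^ m * θ^ (k ℕ.* m)    ≈⟨ *-cong e (θ^-multiple≈1 e k) ⟩
      1# * 1#                ≈⟨ *-identityˡ 1# ⟩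
      1#                     ∎

    θ^-% : ∀ {m} .{{_ : NonZero m}} → θ^ m ≈ 1# → ∀ a → θ^ a ≈ θ^ (a % m)
    θ^-% {m} e a = begin
      θ^ a                               ≈⟨ θ^-≡ (m≡m%n+[m/n]*n a m) ⟩
      θ^ (a % m ℕ.+ (a / m) ℕ.* m)       ≈⟨ θ^-+ (a % m) _ ⟩
      θ^ (a % m) * θ^ ((a / m) ℕ.* m)    ≈⟨ *-congˡ (θ^-multiple≈1 e (a / m)) ⟩
      θ^ (a % m) * 1#                    ≈⟨ *-identityʳ _ ⟩
      θ^ (a % m)                         ∎

    θ^≈1⇒Q≤1+m : ∀ m .{{_ : NonZero m}} → θ^ m ≈ 1# → Q ≤ suc m
    θ^≈1⇒Q≤1+m m e = card-≤-covering setoid cardF h h-onto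
      where
      h : Fin (suc m) → Carrier
      h Fin.zero    = 0#
      h (Fin.suc i) = θ^ (toℕ i)
      h-onto : ∀ x → ⊤ → ∃ λ i → x ≈ h i
      h-onto x _ with x ≈? 0#
      ... | yes x≈0 = Fin.zero , x≈0
      ... | no x≉0 with θ^-onto x x≉0
      ...   | a , θ^a≈x = Fin.suc (fromℕ< (m%n<n a m)) ,
              trans (sym θ^a≈x) (trans (θ^-% e a) (θ^-≡ (≡.sym (Fin.toℕ-fromℕ< (m%n<n a m)))))

    θ^≈1⇒N≤ : ∀ m → 1 ≤ m → θ^ m ≈ 1# → N ≤ m
    θ^≈1⇒N≤ (suc m) _ e = ℕ.≤-pred (≡.subst (_≤ suc (suc m)) Q≡1+N (θ^≈1⇒Q≤1+m (suc m) e))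

    θ^-period : ∃ λ m → 1 ≤ m × m ≤ N × θ^ m ≈ 1#
    θ^-period with Fin.pigeonhole (ℕ.n<1+n Q) (index ∘ h)
      where
      h : Fin (suc Q) → Carrier
      h Fin.zero    = 0#
      h (Fin.suc i) = θ^ (toℕ i)
    ... | Fin.zero , Fin.suc j , _ , e = ⊥-elim (θ^≉0 (toℕ j) (sym (index-≡⇒≈ e)))
    ... | Fin.suc i , Fin.suc j , s≤s i<j , e =
      toℕ j ∸ toℕ i , ℕ.m<n⇒0<n∸m i<j ,
      ℕ.≤-trans (ℕ.m∸n≤m (toℕ j) (toℕ i)) (ℕ.≤-pred (ℕ.≤-trans (Fin.toℕ<n j) (ℕ.≤-reflexive Q≡1+N))) ,
      θ^-cancel (toℕ i) _ (trans (index-≡⇒≈ e) (θ^-≡ (≡.sym (ℕ.m+[n∸m]≡n (ℕ.<⇒≤ i<j)))))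

    θ^N≈1 : θ^ N ≈ 1#
    θ^N≈1 with θ^-period
    ... | m , 1≤m , m≤N , e = ≡.subst (λ k → θ^ k ≈ 1#) (ℕ.≤-antisym m≤N (θ^≈1⇒N≤ m 1≤m e)) e

    θ^≈1⇒≡0 : ∀ {m} → θ^ m ≈ 1# → m ≡[mod N ] 0
    θ^≈1⇒≡0 {m} e with m % N in m%N≡r
    ... | zero  = mod-trans (mod-% m) (mod-reflexive m%N≡r)
    ... | suc r = ⊥-elim (ℕ.<⇒≱ (≡.subst (_< N) m%N≡r (m%n<n m N))
                    (θ^≈1⇒N≤ (suc r) (s≤s z≤n) (trans (θ^-≡ (≡.sym m%N≡r)) (trans (sym (θ^-% θ^N≈1 m)) e))))

    θ^-injective-≤ : ∀ {i j} → i ≤ j → θ^ i ≈ θ^ j → j ≡[mod N ] i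
    θ^-injective-≤ {i} {j} i≤j e =
      mod-trans (mod-reflexive (≡.sym (ℕ.m+[n∸m]≡n i≤j)))
        (mod-trans (mod-+ (mod-refl {x = i}) (θ^≈1⇒≡0 θ^[j∸i]≈1)) (mod-reflexive (ℕ.+-identityʳ i)))
      where
      θ^[j∸i]≈1 : θ^ (j ∸ i) ≈ 1#
      θ^[j∸i]≈1 = θ^-cancel i (j ∸ i) (trans e (θ^-≡ (≡.sym (ℕ.m+[n∸m]≡n i≤j))))

    θ^-injective : ∀ {i j} → θ^ i ≈ θ^ j → i ≡[mod N ] j
    θ^-injective {i} {j} e with ℕ.≤-total i j
    ... | inj₁ i≤j = mod-sym (θ^-injective-≤ i≤j e)
    ... | inj₂ j≤i = θ^-injective-≤ j≤i (sym e)

    θ^-cong : ∀ {i j} → i ≡[mod N ] j → θ^ i ≈ θ^ j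
    θ^-cong {i} {j} (a , b , e) = begin
      θ^ i                   ≈⟨ sym (*-identityʳ _) ⟩
      θ^ i * 1#              ≈⟨ *-congˡ (sym (θ^-multiple≈1 θ^N≈1 a)) ⟩
      θ^ i * θ^ (a ℕ.* N)    ≈⟨ sym (θ^-+ i _) ⟩
      θ^ (i ℕ.+ a ℕ.* N)     ≈⟨ θ^-≡ e ⟩
      θ^ (j ℕ.+ b ℕ.* N)     ≈⟨ θ^-+ j _ ⟩
      θ^ j * θ^ (b ℕ.* N)    ≈⟨ *-congˡ (θ^-multiple≈1 θ^N≈1 b) ⟩
      θ^ j * 1#              ≈⟨ *-identityʳ _ ⟩
      θ^ j                   ∎

  module Subfield {p} (Fq : Carrier → Set p) (subfield : IsSubfield F Fq)
    {q : ℕ} (cardFq : HasCard _≈_ Fq q) where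

    Fq-resp : ∀ {x y} → x ≈ y → Fq x → Fq y
    Fq-resp {x} {y} = proj₁ subfield x y

    Fq-0# : Fq 0#
    Fq-0# = proj₁ (proj₂ subfield)

    Fq-1# : Fq 1#
    Fq-1# = proj₁ (proj₂ (proj₂ subfield))

    Fq-+ : ∀ {x y} → Fq x → Fq y → Fq (x + y)
    Fq-+ {x} {y} = proj₁ (proj₂ (proj₂ (proj₂ subfield))) x y

    Fq-‿ : ∀ {x} → Fq x → Fq (- x)
    Fq-‿ {x} = proj₁ (proj₂ (proj₂ (proj₂ (proj₂ subfield)))) x

    Fq-* : ∀ {x y} → Fq x → Fq y → Fq (x * y)
    Fq-* {x} {y} = proj₁ (proj₂ (proj₂ (proj₂ (proj₂ (proj₂ subfield))))) x y

    Fq-inverse : ∀ {x} → Fq x → ¬ (x ≈ 0#) → ∃ λ y → Fq y × (x * y) ≈ 1#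
    Fq-inverse {x} = proj₂ (proj₂ (proj₂ (proj₂ (proj₂ (proj₂ subfield))))) x

    Fq-- : ∀ {x y} → Fq x → Fq y → Fq (x - y)
    Fq-- x∈ y∈ = Fq-+ x∈ (Fq-‿ y∈)

    Fq-^ : ∀ {x} → Fq x → ∀ k → Fq (x ^ᴿ k)
    Fq-^ x∈ zero    = Fq-1#
    Fq-^ x∈ (suc k) = Fq-* x∈ (Fq-^ x∈ k)

    Fq? : ∀ x → Dec (Fq x)
    Fq? x with Fin.any? (λ j → x ≈? proj₁ cardFq j)
    ... | yes (j , x≈) = yes (Fq-resp (sym x≈) (proj₁ (proj₂ cardFq) j))
    ... | no ∄j        = no λ x∈ → ∄j (proj₂ (proj₂ (proj₂ cardFq)) x x∈)

    Fq-quotient : ∀ {θ δ d} → Fq δ → ¬ (δ ≈ 0#) → Fq d → θ * δ ≈ d → Fq θ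
    Fq-quotient {θ} {δ} {d} δ∈ δ≉0 d∈ θδ≈d with Fq-inverse δ∈ δ≉0
    ... | w , w∈ , δw≈1 = Fq-resp θ≈ (Fq-* d∈ w∈)
      where
      θ≈ : d * w ≈ θ
      θ≈ = begin
        d * w          ≈⟨ *-congʳ (sym θδ≈d) ⟩
        (θ * δ) * w    ≈⟨ *-assoc θ δ w ⟩
        θ * (δ * w)    ≈⟨ *-congˡ δw≈1 ⟩
        θ * 1#         ≈⟨ *-identityʳ θ ⟩
        θ              ∎

    independent : ∀ {θ} → ¬ Fq θ → ∀ {c e c' e'} → Fq c → Fq e → Fq c' → Fq e' →
                  θ * c + e ≈ θ * c' + e' → c ≈ c' × e ≈ e'
    independent {θ} θ∉Fq {c} {e} {c'} {e'} c∈ e∈ c'∈ e'∈ eq with c ≈? c'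
    ... | yes c≈c' = c≈c' , +-cancelˡ (θ * c) e e' (trans eq (+-congʳ (*-congˡ (sym c≈c'))))
    ... | no c≉c' = ⊥-elim (θ∉Fq (Fq-quotient (Fq-+ (Fq-‿ c'∈) c∈) δ≉0 (Fq-- e'∈ e∈) θδ≈e'-e))
      where
      δ = - c' + c
      c'+δ≈c : c' + δ ≈ c
      c'+δ≈c = \\-leftDividesˡ c' c
      δ≉0 : ¬ (δ ≈ 0#)
      δ≉0 δ≈0 = c≉c' (trans (sym c'+δ≈c) (trans (+-congˡ δ≈0) (+-identityʳ c')))
      θδ≈e'-e : θ * δ ≈ e' - e
      θδ≈e'-e = x≈z//y (θ * δ) e e' (+-cancelˡ (θ * c') _ _ (begin
        θ * c' + (θ * δ + e)    ≈⟨ sym (+-assoc _ _ e) ⟩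
        (θ * c' + θ * δ) + e    ≈⟨ +-congʳ (sym (distribˡ θ c' δ)) ⟩
        θ * (c' + δ) + e        ≈⟨ +-congʳ (*-congˡ c'+δ≈c) ⟩
        θ * c + e               ≈⟨ eq ⟩
        θ * c' + e'             ∎))

  module Bose {p} (Fq : Carrier → Set p) (subfield : IsSubfield F Fq)
    {q : ℕ} (cardFq : HasCard _≈_ Fq q)
    (θ : Carrier) (generator : IsGenerator F θ) {N : ℕ} .{{_ : NonZero N}} (Q≡1+N : Q ≡ suc N)
    (q<Q : q < Q) (N≡[q∸1][q+1] : N ≡ (q ∸ 1) ℕ.* (q ℕ.+ 1)) where

    open Subfield Fq subfield cardFq
    open Cyclic θ generator Q≡1+N

    θ∉Fq : ¬ Fq θ
    θ∉Fq θ∈ = ℕ.<⇒≱ q<Q (card-≥-injection setoid cardFq elems (λ i → everything∈ (elems i)) elems-injective)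
      where
      everything∈ : ∀ x → Fq x
      everything∈ x with x ≈? 0#
      ... | yes x≈0 = Fq-resp (sym x≈0) Fq-0#
      ... | no x≉0 with θ^-onto x x≉0
      ...   | a , θ^a≈x = Fq-resp θ^a≈x (Fq-^ θ∈ a)

    Fq-θ^N : Fq (θ^ N)
    Fq-θ^N = Fq-resp (sym θ^N≈1) Fq-1#

    least-exponent : ∃ λ k → Fq (θ^ suc k) × (∀ r → r < k → ¬ Fq (θ^ suc r))
    least-exponent = least-witness (λ r → Fq? (θ^ suc r)) {ℕ.pred N} (≡.subst (Fq ∘ θ^_) (≡.sym (ℕ.suc-pred N)) Fq-θ^N)

    d : ℕ
    d = suc (proj₁ least-exponent)

    Fq-θ^d : Fq (θ^ d)
    Fq-θ^d = proj₁ (proj₂ least-exponent)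

    Fq-θ^⇒d∣ : ∀ a → Fq (θ^ a) → d ∣ a
    Fq-θ^⇒d∣ a θ^a∈ = m%n≡0⇒n∣m a d (remainder-zero (a % d) ≡.refl)
      where
      θ^[a/d*d]∈ : Fq (θ^ ((a / d) ℕ.* d))
      θ^[a/d*d]∈ = Fq-resp (sym (θ^-* d (a / d))) (Fq-^ Fq-θ^d (a / d))
      θ^[a%d]∈ : Fq (θ^ (a % d))
      θ^[a%d]∈ = Fq-quotient θ^[a/d*d]∈ (θ^≉0 ((a / d) ℕ.* d)) θ^a∈
        (trans (sym (θ^-+ (a % d) ((a / d) ℕ.* d))) (θ^-≡ (≡.sym (m≡m%n+[m/n]*n a d))))
      remainder-zero : ∀ r → a % d ≡ r → r ≡ 0
      remainder-zero zero    _ = ≡.refl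
      remainder-zero (suc r) a%d≡1+r = ⊥-elim (proj₂ (proj₂ least-exponent) r
        (ℕ.≤-pred (≡.subst (_< d) a%d≡1+r (m%n<n a d))) (≡.subst (Fq ∘ θ^_) a%d≡1+r θ^[a%d]∈))

    N≡N/d*d : N ≡ (N / d) ℕ.* d
    N≡N/d*d = ≡.sym (m/n*n≡m (Fq-θ^⇒d∣ N Fq-θ^N))

    cardFq-by-d : HasCard _≈_ Fq (suc (N / d))
    cardFq-by-d = h , h∈ , h-injective , h-onto
      where
      h : Fin (suc (N / d)) → Carrier
      h Fin.zero    = 0#
      h (Fin.suc i) = θ^ (toℕ i ℕ.* d)
      h∈ : ∀ i → Fq (h i)
      h∈ Fin.zero    = Fq-0#
      h∈ (Fin.suc i) = Fq-resp (sym (θ^-* d (toℕ i))) (Fq-^ Fq-θ^d (toℕ i))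
      exponent<N : ∀ (i : Fin (N / d)) → toℕ i ℕ.* d < N
      exponent<N i = ≡.subst (toℕ i ℕ.* d <_) (≡.sym N≡N/d*d) (ℕ.*-monoˡ-< d (Fin.toℕ<n i))
      h-injective : ∀ i j → h i ≈ h j → i ≡ j
      h-injective Fin.zero    Fin.zero    _ = ≡.refl
      h-injective Fin.zero    (Fin.suc j) e = ⊥-elim (θ^≉0 (toℕ j ℕ.* d) (sym e))
      h-injective (Fin.suc i) Fin.zero    e = ⊥-elim (θ^≉0 (toℕ i ℕ.* d) e)
      h-injective (Fin.suc i) (Fin.suc j) e = ≡.cong Fin.suc (Fin.toℕ-injective (ℕ.*-cancelʳ-≡ (toℕ i) (toℕ j) d
        (mod-<-unique (exponent<N i) (exponent<N j) (θ^-injective e))))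
      h-onto : ∀ x → Fq x → ∃ λ i → x ≈ h i
      h-onto x x∈ with x ≈? 0#
      ... | yes x≈0 = Fin.zero , x≈0
      ... | no x≉0 with θ^-onto x x≉0
      ...   | a , θ^a≈x = Fin.suc (fromℕ< i<N/d) , (begin
        x                                   ≈⟨ sym θ^a≈x ⟩
        θ^ a                                ≈⟨ θ^-% θ^N≈1 a ⟩
        θ^ (a % N)                          ≈⟨ θ^-≡ (≡.sym (m/n*n≡m d∣a%N)) ⟩
        θ^ ((a % N / d) ℕ.* d)              ≈⟨ θ^-≡ (≡.cong (ℕ._* d) (≡.sym (Fin.toℕ-fromℕ< i<N/d))) ⟩
        θ^ (toℕ (fromℕ< i<N/d) ℕ.* d)       ∎)
        where
        d∣a%N : d ∣ a % N
        d∣a%N = Fq-θ^⇒d∣ (a % N) (Fq-resp (θ^-% θ^N≈1 a) (Fq-resp (sym θ^a≈x) x∈))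
        i<N/d : a % N / d < N / d
        i<N/d = m<n*o⇒m/o<n (≡.subst (a % N <_) N≡N/d*d (m%n<n a N))

    d≡q+1 : d ≡ q ℕ.+ 1
    d≡q+1 with N / d in N/d≡ | card-unique setoid cardFq cardFq-by-d
    ... | zero    | _  = ⊥-elim (ℕ.≢-nonZero⁻¹ N (≡.trans N≡N/d*d (≡.cong (ℕ._* d) N/d≡)))
    ... | suc s   | q≡ = ℕ.*-cancelˡ-≡ d (q ℕ.+ 1) (suc s)
      (≡.trans (≡.cong (ℕ._* d) (≡.sym N/d≡)) (≡.trans (≡.sym N≡N/d*d)
        (≡.trans N≡[q∸1][q+1] (≡.cong (λ n → (n ∸ 1) ℕ.* (q ℕ.+ 1)) q≡))))

    Fq-θ^[k*[q+1]] : ∀ k → Fq (θ^ (k ℕ.* (q ℕ.+ 1)))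
    Fq-θ^[k*[q+1]] k = Fq-resp (sym (θ^-* (q ℕ.+ 1) k)) (Fq-^ (≡.subst (Fq ∘ θ^_) d≡q+1 Fq-θ^d) k)

    α : ℕ → Carrier
    α a = θ^ a - θ

    θ^≈α+θ : ∀ a → θ^ a ≈ α a + θ
    θ^≈α+θ a = sym (//-rightDividesˡ θ (θ^ a))

    α-injective : ∀ {a a'} → α a ≈ α a' → a ≡[mod N ] a'
    α-injective {a} {a'} e = θ^-injective (trans (θ^≈α+θ a) (trans (+-congʳ e) (sym (θ^≈α+θ a'))))

    cardA : HasCard _≡[mod N ]_ (InA F Fq θ) q
    cardA = a , a∈A , a-injective , a-onto
      where
      e : Fin q → Carrier
      e = proj₁ cardFq
      e+θ≉0 : ∀ j → ¬ (e j + θ ≈ 0#)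
      e+θ≉0 j e+θ≈0 = θ∉Fq (Fq-resp (sym (y≈x\\z (e j) θ 0# e+θ≈0)) (Fq-+ (Fq-‿ (proj₁ (proj₂ cardFq) j)) Fq-0#))
      a : Fin q → ℕ
      a j = proj₁ (θ^-onto (e j + θ) (e+θ≉0 j))
      θ^a≈e+θ : ∀ j → θ^ (a j) ≈ e j + θ
      θ^a≈e+θ j = proj₂ (θ^-onto (e j + θ) (e+θ≉0 j))
      α[a]≈e : ∀ j → α (a j) ≈ e j
      α[a]≈e j = +-cancelʳ θ _ _ (trans (sym (θ^≈α+θ (a j))) (θ^a≈e+θ j))
      a∈A : ∀ j → InA F Fq θ (a j)
      a∈A j = Fq-resp (sym (α[a]≈e j)) (proj₁ (proj₂ cardFq) j)
      a-injective : ∀ i j → a i ≡[mod N ] a j → i ≡ j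
      a-injective i j e' = proj₁ (proj₂ (proj₂ cardFq)) i j
        (trans (sym (α[a]≈e i)) (trans (+-congʳ (θ^-cong e')) (α[a]≈e j)))
      a-onto : ∀ b → InA F Fq θ b → ∃ λ j → b ≡[mod N ] a j
      a-onto b b∈A with proj₂ (proj₂ (proj₂ cardFq)) (α b) b∈A
      ... | j , α[b]≈e = j , α-injective (trans α[b]≈e (sym (α[a]≈e j)))

    sidon : ∀ {a a' b b'} → InA F Fq θ a → InA F Fq θ a' → InA F Fq θ b → InA F Fq θ b' →
            (a ℕ.+ b') ≡[mod N ] (a' ℕ.+ b) → a ≡[mod N ] a' ⊎ a ≡[mod N ] b
    sidon {a} {a'} {b} {b'} a∈ a'∈ b∈ b'∈ a+b'≡a'+b =
      Sum.map α-injective α-injective (equal-sum-and-product (proj₁ coefficients) (proj₂ coefficients))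
      where
      expansions-agree : θ * θ + (θ * (α a + α b') + α a * α b') ≈ θ * θ + (θ * (α a' + α b) + α a' * α b)
      expansions-agree = begin
        θ * θ + (θ * (α a + α b') + α a * α b')   ≈⟨ sym (expand θ (α a) (α b')) ⟩
        (α a + θ) * (α b' + θ)                    ≈⟨ sym (*-cong (θ^≈α+θ a) (θ^≈α+θ b')) ⟩
        θ^ a * θ^ b'                              ≈⟨ sym (θ^-+ a b') ⟩
        θ^ (a ℕ.+ b')                             ≈⟨ θ^-cong a+b'≡a'+b ⟩
        θ^ (a' ℕ.+ b)                             ≈⟨ θ^-+ a' b ⟩
        θ^ a' * θ^ b                              ≈⟨ *-cong (θ^≈α+θ a') (θ^≈α+θ b) ⟩
        (α a' + θ) * (α b + θ)                    ≈⟨ expand θ (α a') (α b) ⟩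
        θ * θ + (θ * (α a' + α b) + α a' * α b)   ∎
      coefficients : α a + α b' ≈ α a' + α b × α a * α b' ≈ α a' * α b
      coefficients = independent θ∉Fq (Fq-+ a∈ b'∈) (Fq-* a∈ b'∈) (Fq-+ a'∈ b∈) (Fq-* a'∈ b∈)
        (+-cancelˡ (θ * θ) _ _ expansions-agree)

    shift-by-Fq : ∀ {a a' n} → InA F Fq θ a → InA F Fq θ a' → Fq (θ^ n) →
                  (a ℕ.+ n) ≡[mod N ] a' → a ≡[mod N ] a'
    shift-by-Fq {a} {a'} {n} a∈ a'∈ θ^n∈ a+n≡a' = θ^-injective (begin
      θ^ a             ≈⟨ sym (*-identityʳ _) ⟩
      θ^ a * 1#        ≈⟨ *-congˡ (sym θ^n≈1) ⟩
      θ^ a * θ^ n      ≈⟨ sym (θ^-+ a n) ⟩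
      θ^ (a ℕ.+ n)     ≈⟨ θ^-cong a+n≡a' ⟩
      θ^ a'            ∎)
      where
      θ^n≈1 : θ^ n ≈ 1#
      θ^n≈1 = proj₁ (independent θ∉Fq θ^n∈ (Fq-* a∈ θ^n∈) Fq-1# a'∈ (begin
        θ * θ^ n + α a * θ^ n    ≈⟨ +-comm _ _ ⟩
        α a * θ^ n + θ * θ^ n    ≈⟨ sym (distribʳ (θ^ n) (α a) θ) ⟩
        (α a + θ) * θ^ n         ≈⟨ *-congʳ (sym (θ^≈α+θ a)) ⟩
        θ^ a * θ^ n              ≈⟨ sym (θ^-+ a n) ⟩
        θ^ (a ℕ.+ n)             ≈⟨ θ^-cong a+n≡a' ⟩
        θ^ a'                    ≈⟨ θ^≈α+θ a' ⟩
        α a' + θ                 ≈⟨ +-comm _ θ ⟩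
        θ + α a'                 ≈⟨ +-congʳ (sym (*-identityʳ θ)) ⟩
        θ * 1# + α a'            ∎))

    A-distinct-mod-multiple : ∀ m t .{{_ : NonZero t}} {a a'} → N ≡ (m ℕ.* (q ℕ.+ 1)) ℕ.* t →
      InA F Fq θ a → InA F Fq θ a' → a ≡[mod m ℕ.* (q ℕ.+ 1) ] a' → a ≡[mod N ] a'
    A-distinct-mod-multiple m t {a} {a'} N≡ a∈ a'∈ a≡a' with mod-refine (m ℕ.* (q ℕ.+ 1)) t a≡a'
    ... | k , a+kg≡a' = shift-by-Fq {n = k ℕ.* (m ℕ.* (q ℕ.+ 1))} a∈ a'∈
      (≡.subst (Fq ∘ θ^_) (ℕ.*-assoc k m (q ℕ.+ 1)) (Fq-θ^[k*[q+1]] (k ℕ.* m)))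
      (≡.subst (λ M → (a ℕ.+ k ℕ.* (m ℕ.* (q ℕ.+ 1))) ≡[mod M ] a') (≡.sym N≡) a+kg≡a')

module CosetGraph {p} (g t : ℕ) .{{_ : NonZero g}} .{{_ : NonZero t}}
  {N : ℕ} .{{_ : NonZero N}} (N≡g*t : N ≡ g ℕ.* t)
  (InA : ℕ → Set p) {q : ℕ} (cardA : HasCard _≡[mod N ]_ InA q)
  (sidon : ∀ {a a' b b'} → InA a → InA a' → InA b → InA b' →
           (a ℕ.+ b') ≡[mod N ] (a' ℕ.+ b) → a ≡[mod N ] a' ⊎ a ≡[mod N ] b)
  (A-distinct : ∀ {a a'} → InA a → InA a' → a ≡[mod g ] a' → a ≡[mod N ] a')
  where

  open import Data.Nat using (_+_; _*_)
  open import Data.Nat.Tactic.RingSolver using (solve-∀)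
  open import Algebra.Properties.CommutativeSemigroup ℕ.+-commutativeSemigroup using (xy∙z≈xz∙y)
  open Graph N g InA

  N⇒g : ∀ {x y} → x ≡[mod N ] y → x ≡[mod g ] y
  N⇒g = mod-coarsen g t ∘ ≡.subst (λ M → _ ≡[mod M ] _) N≡g*t

  g⇒N : ∀ {x y} → x ≡[mod g ] y → ∃ λ k → (x + k * g) ≡[mod N ] y
  g⇒N {x} {y} e with mod-refine g t e
  ... | k , e' = k , ≡.subst (λ M → (x + k * g) ≡[mod M ] y) (≡.sym N≡g*t) e'

  SameCoset⇒≡ : ∀ {x y} → SameCoset N g x y → x ≡[mod g ] y
  SameCoset⇒≡ {x} {y} (h , (k , h≡kg) , x+h≡y) = begin
    x          ≈⟨ mod-reflexive (≡.sym (ℕ.+-identityʳ x)) ⟩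
    x + 0      ≈⟨ mod-+ (mod-refl {x = x}) (mod-trans (N⇒g h≡kg) (mod-+-multiple 0 k)) ⟨
    x + h      ≈⟨ N⇒g x+h≡y ⟩
    y          ∎
    where open ModReasoning g

  ≡⇒SameCoset : ∀ {x y} → x ≡[mod g ] y → SameCoset N g x y
  ≡⇒SameCoset e with g⇒N e
  ... | k , e' = k * g , (k , mod-refl) , e'

  module _ {u v} (adj : Adj u v) where

    difference : ℕ
    difference = proj₁ (proj₂ adj)

    difference∈A : InA difference
    difference∈A = proj₁ (proj₂ (proj₂ adj))

    +difference : (u + difference) ≡[mod g ] v
    +difference = mod-trans (mod-+ (mod-sym (SameCoset⇒≡ x~u)) mod-refl) (SameCoset⇒≡ x+a~v)
      where
      x~u = proj₁ (proj₂ (proj₂ (proj₂ adj)))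
      x+a~v = proj₂ (proj₂ (proj₂ (proj₂ adj)))

  ≡⇒Adj : ∀ {u v a} → InA a → (u + a) ≡[mod g ] v → Adj u v
  ≡⇒Adj {u} {v} {a} a∈ e = u , a , a∈ , ≡⇒SameCoset mod-refl , ≡⇒SameCoset e

  to-residue : ∀ x → x ≡[mod g ] toℕ (fromℕ< (m%n<n x g))
  to-residue x = mod-trans (mod-% x) (mod-reflexive (≡.sym (Fin.toℕ-fromℕ< (m%n<n x g))))

  cardVertices : HasCard (SameCoset N g) (λ _ → ⊤) g
  cardVertices = toℕ , (λ _ → tt) ,
    (λ i j i~j → Fin.toℕ-injective (mod-<-unique (Fin.toℕ<n i) (Fin.toℕ<n j) (SameCoset⇒≡ i~j))) ,
    (λ x _ → fromℕ< (m%n<n x g) , ≡⇒SameCoset (to-residue x))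

  private
    a : Fin q → ℕ
    a = proj₁ cardA

    a∈A : ∀ j → InA (a j)
    a∈A = proj₁ (proj₂ cardA)

  edge : Fin q × Fin g → ℕ × ℕ
  edge (j , i) = toℕ i , toℕ i + a j

  edge-injective : ∀ P P' → EdgeEq (edge P) (edge P') → P ≡ P'
  edge-injective (j , i) (j' , i') (i~i' , e)
    with Fin.toℕ-injective (mod-<-unique (Fin.toℕ<n i) (Fin.toℕ<n i') (SameCoset⇒≡ i~i'))
  ... | ≡.refl = ≡.cong (_, i) (proj₁ (proj₂ (proj₂ cardA)) j j'
                   (A-distinct (a∈A j) (a∈A j') (mod-cancelˡ (toℕ i) (SameCoset⇒≡ e))))

  cardEdges : HasCard EdgeEq EdgeP (q * g)
  cardEdges = edge ∘ Fin.remQuot g , (λ c → ≡⇒Adj (a∈A _) mod-refl) , injective , onto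
    where
    injective : ∀ c c' → EdgeEq (edge (Fin.remQuot g c)) (edge (Fin.remQuot g c')) → c ≡ c'
    injective c c' e = ≡.trans (≡.sym (Fin.combine-remQuot {q} g c))
      (≡.trans (≡.cong (uncurry Fin.combine) (edge-injective _ _ e)) (Fin.combine-remQuot {q} g c'))
    onto : ∀ uv → EdgeP uv → ∃ λ c → EdgeEq uv (edge (Fin.remQuot g c))
    onto (u , v) adj with proj₂ (proj₂ (proj₂ cardA)) (difference adj) (difference∈A adj)
    ... | j , d≡aj = Fin.combine j i ,
      ≡.subst (λ P → EdgeEq (u , v) (edge P)) (≡.sym (Fin.remQuot-combine j i))
        (≡⇒SameCoset u≡i , ≡⇒SameCoset (mod-trans (mod-sym (+difference adj)) (mod-+ u≡i (N⇒g d≡aj))))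
      where
      i = fromℕ< (m%n<n u g)
      u≡i = to-residue u

  module Representations {U V : ℕ} (A B : Fin (t + 1) → ℕ)
    (U+A≡V+B : ∀ k → (U + A k) ≡[mod g ] (V + B k)) where

    multiplier : Fin (t + 1) → ℕ
    multiplier k = proj₁ (g⇒N (U+A≡V+B k))

    lift : ∀ k → (U + A k + multiplier k * g) ≡[mod N ] (V + B k)
    lift k = proj₂ (g⇒N (U+A≡V+B k))

    class : Fin (t + 1) → Fin t
    class k = fromℕ< (m%n<n (multiplier k) t)

    same-class⇒cross : ∀ k k' → class k ≡ class k' → (A k + B k') ≡[mod N ] (A k' + B k)
    same-class⇒cross k k' same = mod-cancelˡ (U + V + M) (begin
      (U + V + M) + (A k + B k')            ≡⟨ gather U V M (A k) (B k') ⟩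
      (U + A k + M) + (V + B k')            ≈⟨ mod-+ (lift k) (mod-sym (lift k')) ⟩
      (V + B k) + (U + A k' + M')           ≈⟨ mod-+ (mod-refl {x = V + B k}) (mod-+ (mod-refl {x = U + A k'}) M'≡M) ⟩
      (V + B k) + (U + A k' + M)            ≡⟨ scatter U V M (A k') (B k) ⟩
      (U + V + M) + (A k' + B k)            ∎)
      where
      open ModReasoning N
      M = multiplier k * g
      M' = multiplier k' * g
      M'≡M : M' ≡[mod N ] M
      M'≡M = ≡.subst (λ L → M' ≡[mod L ] M) (≡.sym N≡g*t) (mod-scale g t (%≡⇒mod (
        ≡.trans (≡.sym (Fin.toℕ-fromℕ< (m%n<n (multiplier k') t)))
          (≡.trans (≡.cong toℕ (≡.sym same)) (Fin.toℕ-fromℕ< (m%n<n (multiplier k) t))))))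
      gather : ∀ U V M a b → (U + V + M) + (a + b) ≡ (U + a + M) + (V + b)
      gather = solve-∀
      scatter : ∀ U V M a b → (V + b) + (U + a + M) ≡ (U + V + M) + (a + b)
      scatter = solve-∀

  at-most-t-representations : ∀ {U V} → ¬ (U ≡[mod g ] V) → (A B : Fin (t + 1) → ℕ) →
    (∀ k → InA (A k)) → (∀ k → InA (B k)) → (∀ k → (U + A k) ≡[mod g ] (V + B k)) →
    (∀ k k' → A k ≡[mod N ] A k' → k ≡ k') → ⊥
  at-most-t-representations {U} {V} U≢V A B A∈ B∈ U+A≡V+B A-injective =
    collision (Fin.pigeonhole (ℕ.m<m+n t (s≤s z≤n)) class)
    where
    open Representations A B U+A≡V+B
    collision : (∃ λ k → ∃ λ k' → k Fin.< k' × class k ≡ class k') → ⊥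
    collision (k , k' , k<k' , same) =
      Sum.[ (λ Ak≡Ak' → Fin.<⇒≢ k<k' (A-injective k k' Ak≡Ak'))
          , (λ Ak≡Bk → U≢V (mod-cancelʳ (A k) (mod-trans (U+A≡V+B k) (mod-+ (mod-refl {x = V}) (mod-sym (N⇒g Ak≡Bk))))))
          ]′ (sidon (A∈ k) (A∈ k') (B∈ k) (B∈ k') (same-class⇒cross k k' same))

  Edge : Bool → ℕ → ℕ → Set p
  Edge false x y = Adj x y
  Edge true  x y = Adj y x

  GAdj⇒Edge : ∀ {b x} Y → GAdj (b , x) Y → proj₁ Y ≡ not b × Edge b x (proj₂ Y)
  GAdj⇒Edge {false} (true  , y) adj = ≡.refl , adj
  GAdj⇒Edge {true}  (false , y) adj = ≡.refl , adj

  no-common-neighbours : ∀ b {x₀ x₁} → ¬ (x₀ ≡[mod g ] x₁) → (y : Fin (t + 1) → ℕ) →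
    (∀ k k' → y k ≡[mod g ] y k' → k ≡ k') →
    (∀ k → Edge b x₀ (y k)) → (∀ k → Edge b x₁ (y k)) → ⊥
  no-common-neighbours false {x₀} {x₁} x₀≢x₁ y y-injective e₀ e₁ =
    at-most-t-representations x₀≢x₁ (λ k → difference (e₀ k)) (λ k → difference (e₁ k))
      (λ k → difference∈A (e₀ k)) (λ k → difference∈A (e₁ k))
      (λ k → mod-trans (+difference (e₀ k)) (mod-sym (+difference (e₁ k))))
      (λ k k' e → y-injective k k' (mod-trans (mod-sym (+difference (e₀ k)))
        (mod-trans (mod-+ (mod-refl {x = x₀}) (N⇒g e)) (+difference (e₀ k')))))
  no-common-neighbours true {x₀} {x₁} x₀≢x₁ y y-injective e₀ e₁ =
    at-most-t-representations (x₀≢x₁ ∘ mod-sym) A B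
      (λ k → difference∈A (e₀ k)) (λ k → difference∈A (e₁ k)) x₁+A≡x₀+B
      (λ k k' e → y-injective k k' (mod-cancelʳ (A k) (mod-trans (+difference (e₀ k))
        (mod-trans (mod-sym (+difference (e₀ k'))) (mod-+ (mod-refl {x = y k'}) (mod-sym (N⇒g e)))))))
    where
    A B : Fin (t + 1) → ℕ
    A k = difference (e₀ k)
    B k = difference (e₁ k)
    x₁+A≡x₀+B : ∀ k → (x₁ + A k) ≡[mod g ] (x₀ + B k)
    x₁+A≡x₀+B k = begin
      x₁ + A k            ≈⟨ mod-+ (+difference (e₁ k)) (mod-refl {x = A k}) ⟨
      (y k + B k) + A k   ≡⟨ xy∙z≈xz∙y (y k) (B k) (A k) ⟩
      (y k + A k) + B k   ≈⟨ mod-+ (+difference (e₀ k)) (mod-refl {x = B k}) ⟩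
      x₀ + B k            ∎
      where open ModReasoning g

  no-K₂,ₜ₊₁ : ∀ X₀ X₁ (Y : Fin (t + 1) → Vertex) → ¬ VEq X₀ X₁ →
    (∀ k k' → VEq (Y k) (Y k') → k ≡ k') →
    (∀ k → GAdj X₀ (Y k)) → (∀ k → GAdj X₁ (Y k)) → ⊥
  no-K₂,ₜ₊₁ (b , x₀) (b₁ , x₁) Y X₀≢X₁ Y-injective adj₀ adj₁ =
    no-common-neighbours b (λ e → X₀≢X₁ (≡.sym b₁≡b , ≡⇒SameCoset e)) (proj₂ ∘ Y)
      (λ k k' e → Y-injective k k' (≡.trans (side₀ k) (≡.sym (side₀ k')) , ≡⇒SameCoset e))
      (λ k → proj₂ (GAdj⇒Edge (Y k) (adj₀ k)))
      (λ k → ≡.subst (λ c → Edge c x₁ (proj₂ (Y k))) b₁≡b (proj₂ (GAdj⇒Edge (Y k) (adj₁ k))))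
    where
    side₀ : ∀ k → proj₁ (Y k) ≡ not b
    side₀ k = proj₁ (GAdj⇒Edge (Y k) (adj₀ k))
    b₁≡b : b₁ ≡ b
    b₁≡b = not-injective (≡.trans (≡.sym (proj₁ (GAdj⇒Edge (Y k₀) (adj₁ k₀)))) (side₀ k₀))
      where k₀ = fromℕ< (ℕ.m≤n+m 1 t)

  K-free : ¬ ContainsK VEq GAdj 2 (t + 1)
  K-free (f , f-injective , f-adj) = no-K₂,ₜ₊₁ (f (inj₁ 0F)) (f (inj₁ 1F)) (f ∘ inj₂)
    (λ e → contradiction (f-injective (inj₁ 0F) (inj₁ 1F) e) λ ())
    (λ k k' e → inj₂-injective (f-injective (inj₂ k) (inj₂ k') e))
    (λ k → f-adj (inj₁ 0F) (inj₂ k) tt) (λ k → f-adj (inj₁ 1F) (inj₂ k) tt)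

open import Data.Nat using (ℕ; _+_; _*_; _∸_; _^_; _/_; NonZero)
open import Data.Nat.Primality using (prime⇒nonZero; prime⇒nonTrivial)
open import Algebra.Properties.CommutativeSemigroup ℕ.*-commutativeSemigroup
  using () renaming (xy∙z≈xz∙y to *-right-comm)

prime-power≥2 : ∀ {q} → IsPrimePower q → 2 ≤ q
prime-power≥2 (p , suc k , p-prime , _ , ≡.refl) =
  ℕ.≤-trans (ℕ.nonTrivial⇒n>1 p {{prime⇒nonTrivial p-prime}})
    (ℕ.m≤m*n p (p ^ k) {{ℕ.m^n≢0 p k {{prime⇒nonZero p-prime}}}})

q²∸1≡[q∸1][q+1] : ∀ q → q ^ 2 ∸ 1 ≡ (q ∸ 1) * (q + 1)
q²∸1≡[q∸1][q+1] zero    = ≡.refl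
q²∸1≡[q∸1][q+1] (suc r) = ≡.cong (_∸ 1) (expand r)
  where
  open import Data.Nat.Tactic.RingSolver using (solve-∀)
  expand : ∀ r → (1 + r) * ((1 + r) * 1) ≡ 1 + r * ((1 + r) + 1)
  expand = solve-∀

q<q² : ∀ {q} → 2 ≤ q → q < q ^ 2
q<q² {q@(suc _)} 2≤q = ≡.subst (q <_) (≡.cong (q *_) (≡.sym (ℕ.*-identityʳ q))) (ℕ.m<m*n q q 2≤q)

lemma2 : ∀ {c ℓ p} (t q : ℕ) .{{_ : NonZero t}} → IsPrimePower q → t ∣ (q ∸ 1)
         → (F : CommutativeRing c ℓ) → IsField F
         → HasCard (CommutativeRing._≈_ F) (λ _ → ⊤) (q ^ 2)
         → (Fq : CommutativeRing.Carrier F → Set p) → IsSubfield F Fq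
         → HasCard (CommutativeRing._≈_ F) Fq q
         → (θ : CommutativeRing.Carrier F) → IsGenerator F θ
         → let N = q ^ 2 ∸ 1
               g = ((q ∸ 1) / t) * (q + 1)
               open Graph N g (InA F Fq θ)
           in HasCard (SameCoset N g) (λ _ → ⊤) ((q ^ 2 ∸ 1) / t)
              × ¬ ContainsK VEq GAdj 2 (t + 1)
              × HasCard EdgeEq EdgeP (q * ((q ^ 2 ∸ 1) / t))
lemma2 t q q-prime-power t∣q∸1 F isField cardF Fq subfield cardFq θ generator
  with prime-power≥2 q-prime-power
-- Exposing q = 2 + r makes q ^ 2 ≡ suc N and NonZero N hold by computation.
... | 2≤q@(s≤s (s≤s z≤n)) =
  ≡.subst (HasCard (SameCoset N g) (λ _ → ⊤)) (≡.sym N/t≡g) cardVertices ,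
  K-free ,
  ≡.subst (HasCard EdgeEq EdgeP) (≡.cong (q *_) (≡.sym N/t≡g)) cardEdges
  where
  N = q ^ 2 ∸ 1
  g = ((q ∸ 1) / t) * (q + 1)
  N≡g*t : N ≡ g * t
  N≡g*t = ≡.trans (q²∸1≡[q∸1][q+1] q)
    (≡.trans (≡.cong (_* (q + 1)) (≡.sym (m/n*n≡m t∣q∸1))) (*-right-comm ((q ∸ 1) / t) t (q + 1)))
  instance
    g≢0 : NonZero g
    g≢0 = ℕ.≢-nonZero λ g≡0 → ℕ.≢-nonZero⁻¹ N (≡.trans N≡g*t (≡.cong (_* t) g≡0))
  N/t≡g : N / t ≡ g
  N/t≡g = ≡.trans (≡.cong (_/ t) N≡g*t) (m*n/n≡m g t)
  open FiniteField F isField cardF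
  open Bose Fq subfield cardFq θ generator {N} ≡.refl (q<q² 2≤q) (q²∸1≡[q∸1][q+1] q)
  open CosetGraph g t N≡g*t (InA F Fq θ) cardA sidon (A-distinct-mod-multiple ((q ∸ 1) / t) t N≡g*t)
  open Graph N g (InA F Fq θ)
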